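{- Let $G_k$ be the strongly connected (hence source-free), twin-free and quasi-twin-free digraph of order $n=3k+2$ obtained from $k$ vertex-disjoint directed triangles by adding a new vertex $s$ that is an out-neighbour of all vertices of each triangle, a vertex $t$ that is an in-neighbour of all vertices of each triangle, and an arc from $s$ to $t$. Then $\gamma_L(G_k)=\frac{2(n-2)}{3}$.
   Context: Digraphs are loopless without multiple arcs. A dominating set of a digraph $G$ is a set $D$ of vertices such that every vertex not in $D$ has an in-neighbour in $D$. A set $S$ is locating if every vertex not in $S$ has a distinct set of in-neighbours in $S$. A set is locating-dominating if it is both locating and dominating; $\gamma_L(G)$ denotes the minimum size of a locating-dominating set of $G$ (the location-domination number). Two vertices are twins if they have the same open in-neighbourhood or the same closed in-neighbourhood; $x,y$ are quasi-twins if $N^-(x)=N^-(y)\cup\{y\}$. -}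

module Defs where

open import Level using (0ℓ)
open import Data.Nat using (ℕ; _≤_)
open import Data.Fin using (Fin; zero; suc)
open import Data.List using (List; length)
open import Data.List.Membership.Propositional using (_∈_; _∉_)
open import Data.List.Relation.Unary.Unique.Propositional using (Unique)
open import Data.Product using (Σ; ∃; _×_; _,_)
open import Relation.Binary.PropositionalEquality using (_≡_; _≢_)
open import Relation.Nullary using (¬_)
open import Function.Bundles using (_⇔_)

record Digraph : Set₁ where
  field
    V        : Set
    Arc      : V → V → Set
    loopless : ∀ v → ¬ Arc v v
open Digraph public

-- Finite vertex sets are represented by duplicate-free lists; size = length.
module _ (G : Digraph) where

  Dominating : List (V G) → Set
  Dominating D = ∀ v → v ∉ D → ∃ λ u → u ∈ D × Arc G u v

  Locating : List (V G) → Set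
  Locating S = ∀ x y → x ∉ S → y ∉ S → x ≢ y →
    ¬ (∀ w → w ∈ S → (Arc G w x ⇔ Arc G w y))

  LocatingDominating : List (V G) → Set
  LocatingDominating S = Unique S × Dominating S × Locating S

  LocationDominationNumber : ℕ → Set
  LocationDominationNumber m =
    (∃ λ S → LocatingDominating S × length S ≡ m) ×
    (∀ S → LocatingDominating S → m ≤ length S)

data Vk (k : ℕ) : Set where
  tri : Fin k → Fin 3 → Vk k
  s   : Vk k
  t   : Vk k

next3 : Fin 3 → Fin 3
next3 zero             = suc zero
next3 (suc zero)       = suc (suc zero)
next3 (suc (suc zero)) = zero

data ArcGk {k : ℕ} : Vk k → Vk k → Set where
  tri-arc : ∀ i j → ArcGk (tri i j) (tri i (next3 j))
  to-s    : ∀ i j → ArcGk (tri i j) s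
  from-t  : ∀ i j → ArcGk t (tri i j)
  s-t     : ArcGk s t

open import Data.Empty using (⊥)
open import Relation.Binary.PropositionalEquality using (refl; cong)

next3-noFix : ∀ j → next3 j ≢ j
next3-noFix zero ()
next3-noFix (suc zero) ()
next3-noFix (suc (suc zero)) ()

tri-j : ∀ {k} → Vk k → Fin 3
tri-j (tri _ j) = j
tri-j s = zero
tri-j t = zero

loopless-Gk-aux : ∀ {k} {u w : Vk k} → ArcGk u w → u ≡ w → ⊥
loopless-Gk-aux (tri-arc i j) e = next3-noFix j (cong tri-j (Relation.Binary.PropositionalEquality.sym e))
loopless-Gk-aux (to-s i j) ()
loopless-Gk-aux (from-t i j) ()
loopless-Gk-aux s-t ()

G : ℕ → Digraph
G k = record { V = Vk k ; Arc = ArcGk ; loopless = λ v a → loopless-Gk-aux a refl }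

-- Lower bound: t is dominated only by s, so S meets {s, t}. A vertex outside S whose
-- S-in-neighbours are exactly {t} has trace {t}, so by location there is at most one such
-- vertex. A triangle with at most one vertex in S contains one (the successor of a vertex
-- outside S), hence every triangle meets S twice except at most one, which meets it once:
-- |S| ≥ 1 + 2k − 1 = 2k.
-- Upper bound: S = {t, (0,0)} ∪ {(i,0), (i,1) : i ≥ 1} is locating-dominating: t dominates
-- the triangles, (0,0) dominates s, and the traces of the vertices outside S are
-- S ∖ {t} (for s), {t,(0,0)}, {t} and {t,(i,1)}.
module Submission where

open import Defs
open import Data.Nat using (ℕ; zero; suc; _+_; _*_; _∸_; _/_; _≤_; z≤n; s≤s)
open import Data.Nat.Properties
  using (+-0-commutativeMonoid; +-suc; +-mono-≤; +-monoˡ-≤; ≤-trans; n≤1+n; *-suc; *-comm; *-assoc; m+n∸n≡m;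
         module ≤-Reasoning)
open import Data.Nat.DivMod using (m*n/n≡m)
open import Algebra.Properties.CommutativeMonoid.Sum +-0-commutativeMonoid
  using (sum; ∑-distrib-+; sum-cong-≗; sum-replicate-zero)
open import Data.Fin using (Fin; zero; suc; _≟_)
open import Data.Fin.Properties using (suc-injective)
open import Data.Fin.Patterns using (0F; 1F; 2F)
open import Data.List using (List; []; _∷_; _++_; map; length; filter; allFin; cartesianProductWith)
open import Data.List.Properties using (length-tabulate; length-++; length-map)
open import Data.List.Membership.Propositional using (_∈_; _∉_)
open import Data.List.Membership.Propositional.Properties
  using (∈-length; ∈-filter⁺; ∈-allFin; ∈-cartesianProductWith⁺; ∈-cartesianProductWith⁻)
open import Data.List.Relation.Unary.Any using (here; there; any?)
import Data.List.Relation.Unary.All as All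
open import Data.List.Relation.Unary.Unique.Propositional using (Unique; []; _∷_)
open import Data.List.Relation.Unary.Unique.Propositional.Properties
  using (cartesianProductWith⁺; allFin⁺)
open import Data.Product using (∃; _×_; _,_; proj₁; proj₂)
open import Data.Sum using (_⊎_; inj₁; inj₂)
open import Data.Empty using (⊥-elim)
open import Data.Bool using (if_then_else_)
open import Relation.Binary.PropositionalEquality
  using (_≡_; _≢_; refl; sym; trans; cong; cong₂; subst; module ≡-Reasoning)
open import Relation.Binary.Definitions using (DecidableEquality)
open import Relation.Nullary using (¬_; Dec; yes; no; does)
open import Relation.Nullary.Decidable using (map′; _×-dec_; decidable-stable)
open import Function using (_∘_; case_of_)
open import Function.Bundles using (_⇔_; mk⇔; Equivalence)
open import Function.Properties.Equivalence using () renaming (sym to ⇔-sym)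

private
  variable
    A : Set
    n k : ℕ

δ : Fin n → Fin n → ℕ
δ i j = if does (i ≟ j) then 1 else 0

∑-δ : (i : Fin n) → sum (δ i) ≡ 1
∑-δ {suc n} zero    = cong suc (sum-replicate-zero n)
∑-δ {suc n} (suc i) = ∑-δ i

fibreSize : (A → Fin n) → Fin n → List A → ℕ
fibreSize f c xs = length (filter (λ x → f x ≟ c) xs)

fibreSize-∷ : (f : A → Fin n) (c : Fin n) (x : A) (xs : List A) →
              fibreSize f c (x ∷ xs) ≡ δ (f x) c + fibreSize f c xs
fibreSize-∷ f c x xs with f x ≟ c
... | yes _ = refl
... | no _  = refl

length≡∑fibreSize : (f : A → Fin n) (xs : List A) → length xs ≡ sum (λ c → fibreSize f c xs)
length≡∑fibreSize {n = n} f [] = sym (sum-replicate-zero n)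
length≡∑fibreSize f (x ∷ xs) = begin
  suc (length xs)                                       ≡⟨ cong₂ _+_ (sym (∑-δ (f x))) (length≡∑fibreSize f xs) ⟩
  sum (δ (f x)) + sum (λ c → fibreSize f c xs)          ≡⟨ sym (∑-distrib-+ (δ (f x)) _) ⟩
  sum (λ c → δ (f x) c + fibreSize f c xs)              ≡⟨ sum-cong-≗ (λ c → sym (fibreSize-∷ f c x xs)) ⟩
  sum (λ c → fibreSize f c (x ∷ xs))                    ∎
  where open ≡-Reasoning

≢-∈⇒2≤length : {x y : A} {xs : List A} → x ∈ xs → y ∈ xs → x ≢ y → 2 ≤ length xs
≢-∈⇒2≤length (here refl) (here refl) x≢y = ⊥-elim (x≢y refl)
≢-∈⇒2≤length (here refl) (there y∈) _   = s≤s (∈-length y∈)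
≢-∈⇒2≤length (there x∈) (here refl) _   = s≤s (∈-length x∈)
≢-∈⇒2≤length (there x∈) (there y∈) x≢y = ≤-trans (≢-∈⇒2≤length x∈ y∈ x≢y) (n≤1+n _)

2*n≤∑ : (f : Fin n → ℕ) → (∀ i → 2 ≤ f i) → 2 * n ≤ sum f
2*n≤∑ {zero}  f f≥2 = z≤n
2*n≤∑ {suc n} f f≥2 = subst (_≤ sum f) (sym (*-suc 2 n)) (+-mono-≤ (f≥2 zero) (2*n≤∑ (f ∘ suc) (f≥2 ∘ suc)))

2*n≤1+∑ : (f : Fin n → ℕ) (B : Fin n → Set) → (∀ i → 2 ≤ f i ⊎ (1 ≤ f i × B i)) →
          (∀ i j → B i → B j → i ≡ j) → 2 * n ≤ suc (sum f)
2*n≤1+∑ {zero} f B bound B-unique = z≤n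
2*n≤1+∑ {suc n} f B bound B-unique = subst (_≤ suc (sum f)) (sym (*-suc 2 n)) (head-bound (bound zero))
  where
  tail-unique : ∀ i j → B (suc i) → B (suc j) → i ≡ j
  tail-unique i j bi bj = suc-injective (B-unique _ _ bi bj)

  head-bound : 2 ≤ f zero ⊎ (1 ≤ f zero × B zero) → 2 + 2 * n ≤ suc (sum f)
  head-bound (inj₁ f₀≥2) = subst (2 + 2 * n ≤_) (+-suc (f zero) _)
    (+-mono-≤ f₀≥2 (2*n≤1+∑ (f ∘ suc) (B ∘ suc) (bound ∘ suc) tail-unique))
  head-bound (inj₂ (f₀≥1 , b₀)) = +-mono-≤ (s≤s f₀≥1) (2*n≤∑ (f ∘ suc) tail≥2)
    where
    tail≥2 : ∀ i → 2 ≤ f (suc i)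
    tail≥2 i with bound (suc i)
    ... | inj₁ fᵢ≥2 = fᵢ≥2
    ... | inj₂ (_ , bᵢ) with B-unique zero (suc i) b₀ bᵢ
    ... | ()

Locating⇒trace-injective : (H : Digraph) → DecidableEquality (V H) → {S : List (V H)} → Locating H S →
  ∀ {x y} → x ∉ S → y ∉ S → (∀ w → w ∈ S → (Arc H w x ⇔ Arc H w y)) → x ≡ y
Locating⇒trace-injective H _≟ᵥ_ locating {x} {y} x∉S y∉S same =
  decidable-stable (x ≟ᵥ y) (λ x≢y → locating x y x∉S y∉S x≢y same)

tri-injective : ∀ {i i′ : Fin k} {j j′} → tri i j ≡ tri i′ j′ → i ≡ i′ × j ≡ j′
tri-injective refl = refl , refl

_≟ᵥ_ : DecidableEquality (Vk k)
tri i j ≟ᵥ tri i′ j′ = map′ (λ (e , e′) → cong₂ tri e e′) tri-injective ((i ≟ i′) ×-dec (j ≟ j′))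
tri _ _ ≟ᵥ s = no λ ()
tri _ _ ≟ᵥ t = no λ ()
s ≟ᵥ tri _ _ = no λ ()
s ≟ᵥ s = yes refl
s ≟ᵥ t = no λ ()
t ≟ᵥ tri _ _ = no λ ()
t ≟ᵥ s = no λ ()
t ≟ᵥ t = yes refl

prev3 : Fin 3 → Fin 3
prev3 0F = 2F
prev3 1F = 0F
prev3 2F = 1F

prev3∘next3 : ∀ j → prev3 (next3 j) ≡ j
prev3∘next3 0F = refl
prev3∘next3 1F = refl
prev3∘next3 2F = refl

next3-injective : ∀ {j j′} → next3 j ≡ next3 j′ → j ≡ j′
next3-injective {j} {j′} e = trans (sym (prev3∘next3 j)) (trans (cong prev3 e) (prev3∘next3 j′))

arc-into-tri : ∀ {u} {i : Fin k} {j} → ArcGk u (tri i j) → u ≡ t ⊎ ∃ λ j′ → u ≡ tri i j′ × next3 j′ ≡ j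
arc-into-tri (tri-arc i j) = inj₂ (j , refl , refl)
arc-into-tri (from-t i j)  = inj₁ refl

arc-into-t : ∀ {u : Vk k} → ArcGk u t → u ≡ s
arc-into-t s-t = refl

_∈?_ : (v : Vk k) (S : List (Vk k)) → Dec (v ∈ S)
v ∈? S = any? (v ≟ᵥ_) S

component : Vk k → Fin (suc k)
component (tri i _) = suc i
component s         = zero
component t         = zero

-- All such w outside S share one trace, namely {t} ∩ S.
TOnly : List (Vk k) → Vk k → Set
TOnly S w = ArcGk t w × (∀ u → u ∈ S → ArcGk u w → u ≡ t)

Deficient : List (Vk k) → Fin k → Set
Deficient S i = ∃ λ j → tri i j ∉ S × TOnly S (tri i j)

module _ {k} {S : List (Vk k)} (locating : Locating (G k) S) where

  TOnly-unique : ∀ {w w′} → w ∉ S → w′ ∉ S → TOnly S w → TOnly S w′ → w ≡ w′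
  TOnly-unique {w} {w′} w∉S w′∉S (t→w , only-t) (t→w′ , only-t′) =
    Locating⇒trace-injective (G k) _≟ᵥ_ locating w∉S w′∉S λ u u∈S →
      mk⇔ (λ u→w → subst (λ v → ArcGk v w′) (sym (only-t u u∈S u→w)) t→w′)
          (λ u→w′ → subst (λ v → ArcGk v w) (sym (only-t′ u u∈S u→w′)) t→w)

  Deficient-unique : ∀ i i′ → Deficient S i → Deficient S i′ → i ≡ i′
  Deficient-unique i i′ (_ , w∉S , w-only) (_ , w′∉S , w′-only) =
    proj₁ (tri-injective (TOnly-unique w∉S w′∉S w-only w′-only))

  next3-TOnly : ∀ i j → tri i j ∉ S → TOnly S (tri i (next3 j))
  next3-TOnly i j tij∉S = from-t i (next3 j) , only-t
    where
    only-t : ∀ u → u ∈ S → ArcGk u (tri i (next3 j)) → u ≡ t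
    only-t u u∈S u→w with arc-into-tri u→w
    ... | inj₁ u≡t = u≡t
    ... | inj₂ (j′ , refl , e) with next3-injective e
    ... | refl = ⊥-elim (tij∉S u∈S)

  triangle-bound : ∀ i → 2 ≤ fibreSize component (suc i) S ⊎
                         (1 ≤ fibreSize component (suc i) S × Deficient S i)
  triangle-bound i = cases (tri i 0F ∈? S) (tri i 1F ∈? S) (tri i 2F ∈? S)
    where
    in-fibre : ∀ {j} → tri i j ∈ S → tri i j ∈ filter (λ x → component x ≟ suc i) S
    in-fibre tij∈S = ∈-filter⁺ (λ x → component x ≟ suc i) tij∈S refl

    one-in : ∀ {j} → tri i j ∈ S → 1 ≤ fibreSize component (suc i) S
    one-in = ∈-length ∘ in-fibre

    two-in : ∀ {j j′} → tri i j ∈ S → tri i j′ ∈ S → j ≢ j′ → 2 ≤ fibreSize component (suc i) S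
    two-in a b j≢j′ = ≢-∈⇒2≤length (in-fibre a) (in-fibre b) (j≢j′ ∘ proj₂ ∘ tri-injective)

    cases : Dec (tri i 0F ∈ S) → Dec (tri i 1F ∈ S) → Dec (tri i 2F ∈ S) →
            2 ≤ fibreSize component (suc i) S ⊎ (1 ≤ fibreSize component (suc i) S × Deficient S i)
    cases (yes a) (yes b) _       = inj₁ (two-in a b λ ())
    cases (yes a) (no _)  (yes c) = inj₁ (two-in a c λ ())
    cases (no _)  (yes b) (yes c) = inj₁ (two-in b c λ ())
    cases (yes a) (no b∉) (no c∉) = inj₂ (one-in a , 2F , c∉ , next3-TOnly i 1F b∉)
    cases (no a∉) (yes b) (no c∉) = inj₂ (one-in b , 0F , a∉ , next3-TOnly i 2F c∉)
    cases (no a∉) (no b∉) (yes c) = inj₂ (one-in c , 1F , b∉ , next3-TOnly i 0F a∉)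
    cases (no a∉) (no b∉) (no c∉) =
      case TOnly-unique b∉ c∉ (next3-TOnly i 0F a∉) (next3-TOnly i 1F b∉) of λ ()

st-bound : ∀ {k} {S : List (Vk k)} → Dominating (G k) S → 1 ≤ fibreSize component zero S
st-bound {S = S} dominating with t ∈? S
... | yes t∈S = ∈-length (∈-filter⁺ (λ x → component x ≟ zero) t∈S refl)
... | no t∉S with dominating t t∉S
... | u , u∈S , u→t with arc-into-t u→t
... | refl = ∈-length (∈-filter⁺ (λ x → component x ≟ zero) u∈S refl)

LocatingDominating⇒2*k≤length : ∀ {k} {S : List (Vk k)} → LocatingDominating (G k) S → 2 * k ≤ length S
LocatingDominating⇒2*k≤length {k} {S} (_ , dominating , locating) = begin
  2 * k                                                        ≤⟨ 2*n≤1+∑ _ (Deficient S) (triangle-bound locating) (Deficient-unique locating) ⟩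
  suc (sum (λ i → fibreSize component (suc i) S))              ≤⟨ +-monoˡ-≤ _ (st-bound dominating) ⟩
  sum (λ c → fibreSize component c S)                          ≡⟨ sym (length≡∑fibreSize component S) ⟩
  length S                                                     ∎
  where open ≤-Reasoning

length-cartesianProductWith : ∀ {B C : Set} (f : A → B → C) xs ys →
  length (cartesianProductWith f xs ys) ≡ length xs * length ys
length-cartesianProductWith f []       ys = refl
length-cartesianProductWith f (x ∷ xs) ys = begin
  length (map (f x) ys ++ cartesianProductWith f xs ys)  ≡⟨ length-++ (map (f x) ys) ⟩
  length (map (f x) ys) + length (cartesianProductWith f xs ys)
    ≡⟨ cong₂ _+_ (length-map (f x) ys) (length-cartesianProductWith f xs ys) ⟩
  length ys + length xs * length ys                      ∎
  where open ≡-Reasoning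

module Witness (k : ℕ) where

  triangleTail : Fin k → Fin 3 → Vk (suc k)
  triangleTail i j = tri (suc i) j

  tail-pairs : List (Vk (suc k))
  tail-pairs = cartesianProductWith triangleTail (allFin k) (0F ∷ 1F ∷ [])

  S : List (Vk (suc k))
  S = t ∷ tri zero 0F ∷ tail-pairs

  length-S : length S ≡ 2 * suc k
  length-S = begin
    2 + length tail-pairs          ≡⟨ cong (2 +_) (length-cartesianProductWith triangleTail (allFin k) _) ⟩
    2 + length (allFin k) * 2      ≡⟨ cong (λ m → 2 + m * 2) (length-tabulate {n = k} (λ i → i)) ⟩
    suc k * 2                      ≡⟨ *-comm (suc k) 2 ⟩
    2 * suc k                      ∎
    where open ≡-Reasoning

  tail-pair-shape : ∀ {x} → x ∈ tail-pairs → ∃ λ i → ∃ λ j → x ≡ tri (suc i) j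
  tail-pair-shape x∈ with ∈-cartesianProductWith⁻ triangleTail (allFin k) _ x∈
  ... | i , j , _ , _ , x≡ = i , j , x≡

  tail-pair-∈ : ∀ i {j} → j ≡ 0F ⊎ j ≡ 1F → tri (suc i) j ∈ S
  tail-pair-∈ i j01 = there (there (∈-cartesianProductWith⁺ triangleTail (∈-allFin i) (j∈ j01)))
    where
    j∈ : ∀ {j} → j ≡ 0F ⊎ j ≡ 1F → j ∈ 0F ∷ 1F ∷ []
    j∈ (inj₁ refl) = here refl
    j∈ (inj₂ refl) = there (here refl)

  unique-S : Unique S
  unique-S = All.tabulate t∉ ∷ All.tabulate tri00∉ ∷ unique-tail
    where
    t∉ : ∀ {x} → x ∈ tri zero 0F ∷ tail-pairs → t ≢ x
    t∉ (here refl) ()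
    t∉ (there x∈) t≡x with tail-pair-shape x∈
    ... | _ , _ , refl = case t≡x of λ ()

    tri00∉ : ∀ {x} → x ∈ tail-pairs → tri zero 0F ≢ x
    tri00∉ x∈ tri00≡x with tail-pair-shape x∈
    ... | _ , _ , refl = case tri00≡x of λ ()

    unique-tail : Unique tail-pairs
    unique-tail = cartesianProductWith⁺ triangleTail
      (λ e → let (i≡ , j≡) = tri-injective e in suc-injective i≡ , j≡)
      (allFin⁺ k) (((λ ()) All.∷ All.[]) ∷ All.[] ∷ [])

  dominating-S : Dominating (G (suc k)) S
  dominating-S (tri i j) _ = t , here refl , from-t i j
  dominating-S s _         = tri zero 0F , there (here refl) , to-s zero 0F
  dominating-S t t∉S       = ⊥-elim (t∉S (here refl))

  data Outside : Vk (suc k) → Set where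
    out-s    : Outside s
    out-01   : Outside (tri zero 1F)
    out-02   : Outside (tri zero 2F)
    out-tail : ∀ i → Outside (tri (suc i) 2F)

  outside : ∀ x → x ∉ S → Outside x
  outside s                   _  = out-s
  outside t                   x∉ = ⊥-elim (x∉ (here refl))
  outside (tri zero 0F)       x∉ = ⊥-elim (x∉ (there (here refl)))
  outside (tri zero 1F)       _  = out-01
  outside (tri zero 2F)       _  = out-02
  outside (tri (suc i) 0F)    x∉ = ⊥-elim (x∉ (tail-pair-∈ i (inj₁ refl)))
  outside (tri (suc i) 1F)    x∉ = ⊥-elim (x∉ (tail-pair-∈ i (inj₂ refl)))
  outside (tri (suc i) 2F)    _  = out-tail i

  Separated : Vk (suc k) → Vk (suc k) → Set
  Separated x y = ¬ (∀ w → w ∈ S → (ArcGk w x ⇔ ArcGk w y))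

  separated-by : ∀ {x y} w → w ∈ S → ArcGk w x → ¬ ArcGk w y → Separated x y
  separated-by w w∈S w→x w↛y same = w↛y (Equivalence.to (same w w∈S) w→x)

  separated-sym : ∀ {x y} → Separated x y → Separated y x
  separated-sym sep same = sep λ w w∈S → ⇔-sym (same w w∈S)

  locating-S : Locating (G (suc k)) S
  locating-S x y x∉ y∉ x≢y = separate (outside x x∉) (outside y y∉) x≢y
    where
    t∈S : t ∈ S
    t∈S = here refl

    tri00∈S : tri zero 0F ∈ S
    tri00∈S = there (here refl)

    separate : ∀ {x y} → Outside x → Outside y → x ≢ y → Separated x y
    separate out-s         out-s          x≢y = ⊥-elim (x≢y refl)
    separate out-01        out-01         x≢y = ⊥-elim (x≢y refl)
    separate out-02        out-02         x≢y = ⊥-elim (x≢y refl)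
    separate (out-tail i)  (out-tail i′)  x≢y =
      separated-by (tri (suc i) 1F) (tail-pair-∈ i (inj₂ refl)) (tri-arc _ _) λ { (tri-arc _ _) → x≢y refl }
    separate out-s         out-01         _ = separated-sym (separated-by t t∈S (from-t _ _) λ ())
    separate out-s         out-02         _ = separated-sym (separated-by t t∈S (from-t _ _) λ ())
    separate out-s         (out-tail _)   _ = separated-sym (separated-by t t∈S (from-t _ _) λ ())
    separate out-01        out-02         _ = separated-by (tri zero 0F) tri00∈S (tri-arc _ _) λ ()
    separate out-01        (out-tail _)   _ = separated-by (tri zero 0F) tri00∈S (tri-arc _ _) λ ()
    separate out-02        (out-tail i)   _ =
      separated-sym (separated-by (tri (suc i) 1F) (tail-pair-∈ i (inj₂ refl)) (tri-arc _ _) λ ())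
    separate x@out-01      y@out-s        x≢y = separated-sym (separate y x (x≢y ∘ sym))
    separate x@out-02      y@out-s        x≢y = separated-sym (separate y x (x≢y ∘ sym))
    separate x@(out-tail _) y@out-s       x≢y = separated-sym (separate y x (x≢y ∘ sym))
    separate x@out-02      y@out-01       x≢y = separated-sym (separate y x (x≢y ∘ sym))
    separate x@(out-tail _) y@out-01      x≢y = separated-sym (separate y x (x≢y ∘ sym))
    separate x@(out-tail _) y@out-02      x≢y = separated-sym (separate y x (x≢y ∘ sym))

  locatingDominating-S : LocatingDominating (G (suc k)) S
  locatingDominating-S = unique-S , dominating-S , locating-S

value : ∀ k → (2 * ((3 * k + 2) ∸ 2)) / 3 ≡ 2 * k
value k = begin
  2 * ((3 * k + 2) ∸ 2) / 3  ≡⟨ cong (λ m → 2 * m / 3) (m+n∸n≡m (3 * k) 2) ⟩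
  2 * (3 * k) / 3            ≡⟨ cong (λ m → 2 * m / 3) (*-comm 3 k) ⟩
  2 * (k * 3) / 3            ≡⟨ cong (_/ 3) (sym (*-assoc 2 k 3)) ⟩
  2 * k * 3 / 3              ≡⟨ m*n/n≡m (2 * k) 3 ⟩
  2 * k                      ∎
  where open ≡-Reasoning

proposition3 : (k : ℕ) → 1 ≤ k →
    LocationDominationNumber (G k) ((2 * ((3 * k + 2) ∸ 2)) / 3)
proposition3 (suc k) _ = subst (LocationDominationNumber (G (suc k))) (sym (value (suc k)))
  ( (S , locatingDominating-S , length-S)
  , λ _ → LocatingDominating⇒2*k≤length )
  where open Witness k
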